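{- For every $n\ge 0$, the maps $\mathrm{code}:R_n\to C_n$ and $\mathrm{decode}:C_n\to R_n$ are mutually inverse: for all $\mathsf{c}\in C_n$ and all $r\in R_n$, $\mathrm{code}(\mathrm{decode}(\mathsf{c}))=\mathsf{c}$ and $\mathrm{decode}(\mathrm{code}(r))=r$.
   Context: A rook (vector) of size $n$ is a word $r=r_1\dots r_n$ over $\{0,1,\dots,n\}$ whose nonzero letters are pairwise distinct; $R_n$ is the set of rooks of size $n$. For a rook $r$ of size $n$, $\mathrm{code}(r)$ is the word over $\mathbb{Z}$ of length $n$ defined recursively: $\mathrm{code}(\varepsilon)=\varepsilon$ (empty word); if $n$ occurs in $r$, write uniquely $r=\underline{b}\,n\,\underline{e}$ and set $\mathrm{code}(r)=\mathrm{code}(\underline{b}\,\underline{e})\cdot(\ell(\underline{b})+1)$; otherwise write uniquely $r=\underline{b}\,0\,\underline{e}$ where $\underline{b}$ contains no $0$, and set $\mathrm{code}(r)=\mathrm{code}(\underline{b}\,\underline{e})\cdot(-\ell(\underline{b}))$ (here $\ell$ is word length and $\cdot$ appends a letter; the shortened word $\underline{b}\,\underline{e}$ is regarded as a rook of size $n-1$). For a word $\underline{w}$ over $\mathbb{Z}$ define $m(\varepsilon)=0$ and $m(\underline{w}d)=-d$ if $d\le 0$, $m(\underline{w})+1$ if $0<d\le m(\underline{w})+1$, and $m(\underline{w})$ if $d>m(\underline{w})+1$. The set $C_n$ of $R$-codes of size $n$ is defined recursively: $\varepsilon\in C_0$, and $\underline{w}d\in C_n$ iff $\underline{w}\in C_{n-1}$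 and $-m(\underline{w})\le d\le n$. For $\mathsf{c}=\mathsf{c}_1\dots\mathsf{c}_n\in C_n$, $\mathrm{decode}(\mathsf{c})$ is defined recursively: $\mathrm{decode}(\varepsilon)=\varepsilon$; with $r'=\mathrm{decode}(\mathsf{c}_1\dots\mathsf{c}_{n-1})$, if $\mathsf{c}_n>0$ insert the letter $n$ into $r'$ so that it occupies position $\mathsf{c}_n$, and if $\mathsf{c}_n\le 0$ insert a letter $0$ into $r'$ so that it occupies position $-\mathsf{c}_n+1$ (positions counted from $1$). -}

module Defs where

open import Data.Nat using (ℕ; zero; suc; _≤_; _≟_; _≤ᵇ_)
open import Data.Integer as ℤ using (ℤ; +_; -[1+_]; +[1+_]; -_)
open import Data.List using (List; []; _∷_; _++_; _∷ʳ_; length; take; drop; filter; foldl)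
open import Data.List.Relation.Unary.All using (All)
open import Data.List.Relation.Unary.Unique.Propositional using (Unique)
open import Data.Maybe using (Maybe; just; nothing)
open import Data.Product using (_×_; _,_)
open import Data.Bool using (if_then_else_)
open import Relation.Nullary using (¬?; yes; no)
open import Relation.Binary.PropositionalEquality using (_≡_)

IsRook : ℕ → List ℕ → Set
IsRook n r =
  length r ≡ n × All (_≤ n) r × Unique (filter (λ x → ¬? (x ≟ 0)) r)

split : ℕ → List ℕ → Maybe (List ℕ × List ℕ)
split x [] = nothing
split x (y ∷ w) with y ≟ x
... | yes _ = just ([] , w)
... | no _ with split x w
...   | nothing = nothing
...   | just (b , e) = just (y ∷ b , e)

-- If n occurs: r = b n e, code(r) = code(b e)·(ℓ(b)+1);
-- otherwise r = b 0 e with 0 ∉ b, code(r) = code(b e)·(−ℓ(b)).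
-- (The final fall-through case is never reached on rooks.)

code : ℕ → List ℕ → List ℤ
code zero r = []
code (suc n) r with split (suc n) r
... | just (b , e) = code n (b ++ e) ∷ʳ (+ suc (length b))
... | nothing with split 0 r
...   | just (b , e) = code n (b ++ e) ∷ʳ (- (+ length b))
...   | nothing = code n r ∷ʳ + 0

-- The statistic m on words over ℤ (its values are in ℕ):
-- m(ε)=0; m(w d) = −d if d ≤ 0; m(w)+1 if 0<d≤m(w)+1; m(w) if d>m(w)+1.

mStep : ℕ → ℤ → ℕ
mStep k (+ zero)   = 0
mStep k -[1+ j ]   = suc j
mStep k +[1+ j ]   = if suc j ≤ᵇ suc k then suc k else k

m : List ℤ → ℕ
m = foldl mStep 0

data IsCode : ℕ → List ℤ → Set where
  nil  : IsCode 0 []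
  snoc : ∀ {n w d} → IsCode n w →
         - (+ m w) ℤ.≤ d → d ℤ.≤ + suc n → IsCode (suc n) (w ∷ʳ d)

-- decode.  insertAt i x r inserts x so that it occupies position i+1.

insertAt : ℕ → ℕ → List ℕ → List ℕ
insertAt i x r = take i r ++ x ∷ drop i r

-- one step of decode: the new letter is k (current size after insertion)
-- c_k > 0 : insert k at position c_k;  c_k ≤ 0 : insert 0 at position −c_k+1.
decodeStep : ℕ → ℤ → List ℕ → List ℕ
decodeStep k (+ zero)  r = insertAt 0 0 r
decodeStep k +[1+ j ]  r = insertAt j k r
decodeStep k -[1+ j ]  r = insertAt (suc j) 0 r

-- decodeFrom r k c: r = decode of the first k letters, c = remaining letters
decodeFrom : List ℕ → ℕ → List ℤ → List ℕ
decodeFrom r k []      = r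
decodeFrom r k (d ∷ c) = decodeFrom (decodeStep (suc k) d r) (suc k) c

decode : List ℤ → List ℕ
decode c = decodeFrom [] 0 c

module Submission where

-- Decoding one letter d inserts the new top letter n at position d, or a 0 at
-- position 1 − d; coding removes n if present and otherwise the first 0.  These
-- one-step operations are mutually inverse on rooks exactly when the inserted 0
-- lands before every other 0, i.e. among the leading nonzero letters.  The
-- statistic m of a code is the number of leading nonzero letters of its decoding,
-- so the lower bound −m(w) ≤ d in the definition of R-codes says precisely that.
-- A rook of size n containing neither n nor 0 is impossible by pigeonhole.

open import Defs
open import Data.Nat as ℕ using (ℕ; zero; suc; _+_; _≤_; _<_; z≤n; s≤s; _≟_)
open import Data.Nat.Properties
  using ( ≤-refl; ≤-trans; ≤-pred; ≤∧≢⇒<; <⇒≢; >⇒≢; 1+n≰n; m≤n⇒m≤1+n; m≤n⇒m⊓n≡m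
        ; +-identityʳ; +-suc; +-comm; suc-injective)
open import Data.Integer as ℤ using (ℤ; +_; -[1+_]; +[1+_]; -_; +≤+)
open import Data.Integer.Properties using (neg-≤-pos; neg-mono-≤; neg-cancel-≤; drop‿+≤+)
open import Data.List using (List; []; _∷_; _++_; _∷ʳ_; length; take; drop; filter)
open import Data.List.Properties
  using (length-++; length-++-≤ˡ; length-take; take++drop≡id; foldl-∷ʳ; filter-all)
open import Data.List.Relation.Unary.All as All using (All; []; _∷_)
open import Data.List.Relation.Unary.All.Properties using (++⁻ˡ; filter⁺; ¬Any⇒All¬)
open import Data.List.Relation.Unary.AllPairs using ([]; _∷_)
open import Data.List.Relation.Unary.Unique.Propositional using (Unique)
open import Data.List.Relation.Binary.Permutation.Propositional using (_↭_; ↭-sym; ↭⇒↭ₛ)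
open import Data.List.Relation.Binary.Permutation.Propositional.Properties
  using (shift; ↭-length; All-resp-↭; filter-↭)
open import Data.List.Relation.Binary.Permutation.Setoid.Properties as Permₛ using ()
open import Data.List.Membership.DecPropositional _≟_ using (_∈?_)
open import Data.List.Membership.Propositional.Properties using (∈-∃++)
open import Data.Maybe using (just; nothing)
open import Data.Product using (Σ; _×_; _,_; proj₁; proj₂; uncurry)
open import Data.Bool.Properties using (if-float)
open import Function using (_∘_)
open import Data.Empty using (⊥-elim)
open import Relation.Nullary using (¬_; ¬?; yes; no)
open import Relation.Binary.PropositionalEquality

nonzeroLetters : List ℕ → List ℕ
nonzeroLetters = filter (λ x → ¬? (x ≟ 0))

Unique-resp-↭ : ∀ {xs ys : List ℕ} → xs ↭ ys → Unique xs → Unique ys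
Unique-resp-↭ p = Permₛ.Unique-resp-↭ (setoid ℕ) (↭⇒↭ₛ p)

≤-suc∧≢⇒≤ : ∀ {x n} → x ≤ suc n → x ≢ suc n → x ≤ n
≤-suc∧≢⇒≤ x≤1+n x≢1+n = ≤-pred (≤∧≢⇒< x≤1+n x≢1+n)

<-suc∧≢⇒< : ∀ {x n} → x < suc n → n ≢ x → x < n
<-suc∧≢⇒< x<1+n n≢x = ≤-suc∧≢⇒≤ x<1+n (n≢x ∘ sym ∘ suc-injective)

unique-bounded⇒length≤ : ∀ n {xs} → Unique xs → All (_< n) xs → length xs ≤ n
unique-bounded⇒length≤ zero {[]} _ _ = z≤n
unique-bounded⇒length≤ zero {_ ∷ _} _ (() ∷ _)
unique-bounded⇒length≤ (suc n) {xs} uniq bnd with n ∈? xs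
... | no n∉xs =
  m≤n⇒m≤1+n (unique-bounded⇒length≤ n uniq
    (All.zipWith (uncurry <-suc∧≢⇒<) (bnd , ¬Any⇒All¬ xs n∉xs)))
... | yes n∈xs with b , e , refl ← ∈-∃++ n∈xs
  with fresh ∷ uniq′ ← Unique-resp-↭ (shift n b e) uniq
     | _ ∷ bnd′ ← All-resp-↭ (shift n b e) bnd =
  subst (_≤ suc n) (sym (↭-length (shift n b e)))
    (s≤s (unique-bounded⇒length≤ n uniq′
      (All.zipWith (uncurry <-suc∧≢⇒<) (bnd′ , fresh))))

split-first : ∀ x b e → All (_≢ x) b → split x (b ++ x ∷ e) ≡ just (b , e)
split-first x [] e _ with x ≟ x
... | yes _ = refl
... | no x≢x = ⊥-elim (x≢x refl)
split-first x (y ∷ b) e (y≢x ∷ b∌x) with y ≟ x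
... | yes y≡x = ⊥-elim (y≢x y≡x)
... | no _ rewrite split-first x b e b∌x = refl

split-absent : ∀ x r → All (_≢ x) r → split x r ≡ nothing
split-absent x [] _ = refl
split-absent x (y ∷ r) (y≢x ∷ r∌x) with y ≟ x
... | yes y≡x = ⊥-elim (y≢x y≡x)
... | no _ rewrite split-absent x r r∌x = refl

split-just⁻ : ∀ x r {b e} → split x r ≡ just (b , e) → r ≡ b ++ x ∷ e × All (_≢ x) b
split-just⁻ x (y ∷ r) eq with y ≟ x
split-just⁻ x (y ∷ r) refl | yes refl = refl , []
split-just⁻ x (y ∷ r) eq | no y≢x with split x r in eq′
split-just⁻ x (y ∷ r) refl | no y≢x | just (b , e) with split-just⁻ x r eq′
... | refl , b∌x = refl , y≢x ∷ b∌x

split-nothing⁻ : ∀ x r → split x r ≡ nothing → All (_≢ x) r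
split-nothing⁻ x [] _ = []
split-nothing⁻ x (y ∷ r) eq with y ≟ x
split-nothing⁻ x (y ∷ r) () | yes _
split-nothing⁻ x (y ∷ r) eq | no y≢x with split x r in eq′
split-nothing⁻ x (y ∷ r) eq | no y≢x | nothing = y≢x ∷ split-nothing⁻ x r eq′

IsRook-resp-↭ : ∀ {n xs ys} → xs ↭ ys → IsRook n xs → IsRook n ys
IsRook-resp-↭ p (len , bnd , uniq) =
  trans (sym (↭-length p)) len , All-resp-↭ p bnd , Unique-resp-↭ (filter-↭ _ p) uniq

letters-≢-suc : ∀ {n r} → All (_≤ n) r → All (_≢ suc n) r
letters-≢-suc = All.map (λ x≤n → <⇒≢ (s≤s x≤n))

letters-≤-pred : ∀ {n r} → All (_≤ suc n) r → All (_≢ suc n) r → All (_≤ n) r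
letters-≤-pred bnd fresh = All.zipWith (uncurry ≤-suc∧≢⇒≤) (bnd , fresh)

nonzeroLetters-All⁻ : ∀ {x} r → x ≢ 0 → All (_≢ x) (nonzeroLetters r) → All (_≢ x) r
nonzeroLetters-All⁻ [] _ _ = []
nonzeroLetters-All⁻ (zero ∷ r) x≢0 fresh =
  (λ 0≡x → x≢0 (sym 0≡x)) ∷ nonzeroLetters-All⁻ r x≢0 fresh
nonzeroLetters-All⁻ (suc y ∷ r) x≢0 (y≢x ∷ fresh) = y≢x ∷ nonzeroLetters-All⁻ r x≢0 fresh

rook-cons-top : ∀ {n r} → IsRook n r → IsRook (suc n) (suc n ∷ r)
rook-cons-top (len , bnd , uniq) =
  cong suc len , ≤-refl ∷ All.map m≤n⇒m≤1+n bnd ,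
  filter⁺ _ (All.map (λ x≤n → >⇒≢ (s≤s x≤n)) bnd) ∷ uniq

rook-cons-zero : ∀ {n r} → IsRook n r → IsRook (suc n) (0 ∷ r)
rook-cons-zero (len , bnd , uniq) = cong suc len , z≤n ∷ All.map m≤n⇒m≤1+n bnd , uniq

rook-uncons-top : ∀ {n r} → IsRook (suc n) (suc n ∷ r) → IsRook n r
rook-uncons-top {r = r} (len , _ ∷ bnd , fresh ∷ uniq) =
  suc-injective len ,
  letters-≤-pred bnd (nonzeroLetters-All⁻ r (λ ()) (All.map ≢-sym fresh)) ,
  uniq

rook-uncons-zero : ∀ {n r} → IsRook (suc n) (0 ∷ r) → All (_≢ suc n) (0 ∷ r) → IsRook n r
rook-uncons-zero (len , _ ∷ bnd , uniq) (_ ∷ fresh) =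
  suc-injective len , letters-≤-pred bnd fresh , uniq

rook-has-zero-or-top : ∀ {n r} → IsRook (suc n) r → ¬ (All (_≢ 0) r × All (_≢ suc n) r)
rook-has-zero-or-top {n} {r} (len , bnd , uniq) (no-zero , no-top) =
  1+n≰n (subst (_≤ suc n) (cong suc len) (unique-bounded⇒length≤ (suc n) uniq₀ bnd₀))
  where
  uniq₀ : Unique (0 ∷ r)
  uniq₀ = All.map ≢-sym no-zero ∷ subst Unique (filter-all _ no-zero) uniq
  bnd₀ : All (_< suc n) (0 ∷ r)
  bnd₀ = s≤s z≤n ∷ All.zipWith (uncurry ≤∧≢⇒<) (bnd , no-top)

leadingNonzeros : List ℕ → ℕ
leadingNonzeros []          = 0
leadingNonzeros (zero ∷ _)  = 0
leadingNonzeros (suc _ ∷ r) = suc (leadingNonzeros r)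

leadingNonzeros-insert-nonzero : ∀ b x e →
  leadingNonzeros (b ++ suc x ∷ e) ≡ mStep (leadingNonzeros (b ++ e)) (+ suc (length b))
leadingNonzeros-insert-nonzero []          x e = refl
leadingNonzeros-insert-nonzero (zero ∷ b)  x e = refl
leadingNonzeros-insert-nonzero (suc y ∷ b) x e
  rewrite leadingNonzeros-insert-nonzero b x e = if-float suc _

leadingNonzeros-insert-zero : ∀ b e → All (_≢ 0) b → leadingNonzeros (b ++ 0 ∷ e) ≡ length b
leadingNonzeros-insert-zero []          e _ = refl
leadingNonzeros-insert-zero (zero ∷ b)  e (0≢0 ∷ _) = ⊥-elim (0≢0 refl)
leadingNonzeros-insert-zero (suc _ ∷ b) e (_ ∷ b≢0) =
  cong suc (leadingNonzeros-insert-zero b e b≢0)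

length≤leadingNonzeros-++ : ∀ b e → All (_≢ 0) b → length b ≤ leadingNonzeros (b ++ e)
length≤leadingNonzeros-++ []          e _ = z≤n
length≤leadingNonzeros-++ (zero ∷ b)  e (0≢0 ∷ _) = ⊥-elim (0≢0 refl)
length≤leadingNonzeros-++ (suc _ ∷ b) e (_ ∷ b≢0) = s≤s (length≤leadingNonzeros-++ b e b≢0)

leadingNonzeros≤length : ∀ r → leadingNonzeros r ≤ length r
leadingNonzeros≤length []          = z≤n
leadingNonzeros≤length (zero ∷ r)  = z≤n
leadingNonzeros≤length (suc _ ∷ r) = s≤s (leadingNonzeros≤length r)

take-leadingNonzeros : ∀ k r → k ≤ leadingNonzeros r → All (_≢ 0) (take k r)
take-leadingNonzeros zero    r           _         = []
take-leadingNonzeros (suc k) []          _         = []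
take-leadingNonzeros (suc k) (suc _ ∷ r) (s≤s k≤) = (λ ()) ∷ take-leadingNonzeros k r k≤

mStep-nonpositive : ∀ k l → mStep k (- (+ l)) ≡ l
mStep-nonpositive k zero    = refl
mStep-nonpositive k (suc l) = refl

insertAt-length : ∀ b x e → insertAt (length b) x (b ++ e) ≡ b ++ x ∷ e
insertAt-length []      x e = refl
insertAt-length (y ∷ b) x e = cong (y ∷_) (insertAt-length b x e)

decodeStep-top : ∀ k b e → decodeStep k (+ suc (length b)) (b ++ e) ≡ b ++ k ∷ e
decodeStep-top k b e = insertAt-length b k e

decodeStep-zero : ∀ k b e → decodeStep k (- (+ length b)) (b ++ e) ≡ b ++ 0 ∷ e
decodeStep-zero k []      e = refl
decodeStep-zero k (y ∷ b) e = insertAt-length (y ∷ b) 0 e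

decodeFrom-∷ʳ : ∀ r k w d →
  decodeFrom r k (w ∷ʳ d) ≡ decodeStep (suc (k + length w)) d (decodeFrom r k w)
decodeFrom-∷ʳ r k []      d rewrite +-identityʳ k = refl
decodeFrom-∷ʳ r k (x ∷ w) d rewrite +-suc k (length w) =
  decodeFrom-∷ʳ (decodeStep (suc k) x r) (suc k) w d

IsCode-length : ∀ {n c} → IsCode n c → length c ≡ n
IsCode-length nil = refl
IsCode-length (snoc {w = w} κ _ _) =
  trans (length-++ w) (trans (+-comm (length w) 1) (cong suc (IsCode-length κ)))

decode-∷ʳ : ∀ {n w} d → IsCode n w → decode (w ∷ʳ d) ≡ decodeStep (suc n) d (decode w)
decode-∷ʳ {w = w} d κ rewrite sym (IsCode-length κ) = decodeFrom-∷ʳ [] 0 w d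

m-∷ʳ : ∀ w d → m (w ∷ʳ d) ≡ mStep (m w) d
m-∷ʳ w d = foldl-∷ʳ mStep 0 d w

code-insert-top : ∀ {n} b e → IsRook n (b ++ e) →
  code (suc n) (b ++ suc n ∷ e) ≡ code n (b ++ e) ∷ʳ + suc (length b)
code-insert-top b e (_ , bnd , _)
  rewrite split-first _ b e (++⁻ˡ b (letters-≢-suc bnd)) = refl

code-insert-zero : ∀ {n} b e → All (_≢ 0) b → IsRook n (b ++ e) →
  code (suc n) (b ++ 0 ∷ e) ≡ code n (b ++ e) ∷ʳ - (+ length b)
code-insert-zero {n} b e b≢0 (_ , bnd , _)
  rewrite split-absent (suc n) (b ++ 0 ∷ e)
            (letters-≢-suc (All-resp-↭ (↭-sym (shift 0 b e)) (z≤n ∷ bnd)))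
        | split-first 0 b e b≢0 = refl

-- The code letters d that decode may append after r: the new top letter placed
-- after a prefix b, or a 0 placed after a zero-free prefix b, so that code finds
-- it again as the first 0.
data Slot (r : List ℕ) : ℤ → Set where
  topAfter  : ∀ b e → r ≡ b ++ e → Slot r (+ suc (length b))
  zeroAfter : ∀ b e → r ≡ b ++ e → All (_≢ 0) b → Slot r (- (+ length b))

length-take-≤ : ∀ k (r : List ℕ) → k ≤ length r → length (take k r) ≡ k
length-take-≤ k r k≤ = trans (length-take k r) (m≤n⇒m⊓n≡m k≤)

slot : ∀ {n r} d → length r ≡ n → - (+ leadingNonzeros r) ℤ.≤ d → d ℤ.≤ + suc n → Slot r d
slot {r = r} (+ zero) _ _ _ = zeroAfter [] r refl []
slot {r = r} +[1+ j ] refl _ (+≤+ (s≤s j≤n)) =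
  subst (λ i → Slot r (+ suc i)) (length-take-≤ j r j≤n)
    (topAfter (take j r) (drop j r) (sym (take++drop≡id j r)))
slot {r = r} -[1+ j ] _ lo _ =
  subst (λ i → Slot r (- (+ i)))
    (length-take-≤ (suc j) r (≤-trans 1+j≤ (leadingNonzeros≤length r)))
    (zeroAfter (take (suc j) r) (drop (suc j) r) (sym (take++drop≡id (suc j) r))
      (take-leadingNonzeros (suc j) r 1+j≤))
  where
  1+j≤ : suc j ≤ leadingNonzeros r
  1+j≤ = drop‿+≤+ (neg-cancel-≤ lo)

slot-bounds : ∀ {r d} → Slot r d → - (+ leadingNonzeros r) ℤ.≤ d × d ℤ.≤ + suc (length r)
slot-bounds (topAfter b e refl) = neg-≤-pos , +≤+ (s≤s (length-++-≤ˡ b))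
slot-bounds (zeroAfter b e refl b≢0) =
  neg-mono-≤ (+≤+ (length≤leadingNonzeros-++ b e b≢0)) , neg-≤-pos

insertion : ∀ {n r d} → IsRook n r → Slot r d →
  IsRook (suc n) (decodeStep (suc n) d r) ×
  code (suc n) (decodeStep (suc n) d r) ≡ code n r ∷ʳ d ×
  leadingNonzeros (decodeStep (suc n) d r) ≡ mStep (leadingNonzeros r) d
insertion {n} ρ (topAfter b e refl) rewrite decodeStep-top (suc n) b e =
  IsRook-resp-↭ (↭-sym (shift (suc n) b e)) (rook-cons-top ρ) ,
  code-insert-top b e ρ ,
  leadingNonzeros-insert-nonzero b n e
insertion {n} ρ (zeroAfter b e refl b≢0) rewrite decodeStep-zero (suc n) b e =
  IsRook-resp-↭ (↭-sym (shift 0 b e)) (rook-cons-zero ρ) ,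
  code-insert-zero b e b≢0 ρ ,
  trans (leadingNonzeros-insert-zero b e b≢0) (sym (mStep-nonpositive _ (length b)))

removal : ∀ {n r} → IsRook (suc n) r →
  Σ (List ℕ) λ r′ → Σ ℤ λ d → IsRook n r′ × Slot r′ d × decodeStep (suc n) d r′ ≡ r
removal {n} {r} ρ with split (suc n) r in top≡ | split 0 r in zero≡
... | just (b , e) | _ with refl , _ ← split-just⁻ (suc n) r top≡ =
  b ++ e , _ , rook-uncons-top (IsRook-resp-↭ (shift (suc n) b e) ρ) , topAfter b e refl ,
  decodeStep-top (suc n) b e
... | nothing | just (b , e) with refl , b≢0 ← split-just⁻ 0 r zero≡ =
  b ++ e , _ ,
  rook-uncons-zero (IsRook-resp-↭ (shift 0 b e) ρ)
    (All-resp-↭ (shift 0 b e) (split-nothing⁻ (suc n) r top≡)) ,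
  zeroAfter b e refl b≢0 , decodeStep-zero (suc n) b e
... | nothing | nothing =
  ⊥-elim (rook-has-zero-or-top ρ
    (split-nothing⁻ 0 r zero≡ , split-nothing⁻ (suc n) r top≡))

Decodes : ℕ → List ℤ → List ℕ → Set
Decodes n c r = IsRook n r × code n r ≡ c × m c ≡ leadingNonzeros r

Decodes-∷ʳ : ∀ {n w r} d → Decodes n w r → - (+ m w) ℤ.≤ d → d ℤ.≤ + suc n →
  Decodes (suc n) (w ∷ʳ d) (decodeStep (suc n) d r)
Decodes-∷ʳ {n} {r = r} d (ρ , refl , mw≡) lo hi
  with ρ⁺ , code≡ , leading≡ ←
       insertion ρ (slot d (proj₁ ρ) (subst (λ k → - (+ k) ℤ.≤ d) mw≡ lo) hi) =
  ρ⁺ , code≡ ,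
  trans (m-∷ʳ (code n r) d) (trans (cong (λ k → mStep k d) mw≡) (sym leading≡))

decode-correct : ∀ {n c} → IsCode n c → Decodes n c (decode c)
decode-correct nil = (refl , [] , []) , refl , refl
decode-correct (snoc {d = d} κ lo hi)
  rewrite decode-∷ʳ d κ = Decodes-∷ʳ d (decode-correct κ) lo hi

code-correct : ∀ n {r} → IsRook n r → IsCode n (code n r) × decode (code n r) ≡ r
code-correct zero {[]} _ = nil , refl
code-correct (suc n) ρ
  with r′ , d , ρ′ , σ , refl ← removal ρ
  with _ , code≡ , _ ← insertion ρ′ σ
  with κ , decode≡ ← code-correct n ρ′
  rewrite code≡ =
  snoc κ lo hi , trans (decode-∷ʳ d κ) (cong (decodeStep (suc n) d) decode≡)
  where
  m≡ : m (code n r′) ≡ leadingNonzeros r′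
  m≡ = trans (proj₂ (proj₂ (decode-correct κ))) (cong leadingNonzeros decode≡)
  lo : - (+ m (code n r′)) ℤ.≤ d
  lo = subst (λ k → - (+ k) ℤ.≤ d) (sym m≡) (proj₁ (slot-bounds σ))
  hi : d ℤ.≤ + suc n
  hi = subst (λ k → d ℤ.≤ + suc k) (proj₁ ρ′) (proj₂ (slot-bounds σ))

theorem3p27 : (n : ℕ) →
    ((c : List ℤ) → IsCode n c → IsRook n (decode c) × code n (decode c) ≡ c) ×
    ((r : List ℕ) → IsRook n r → IsCode n (code n r) × decode (code n r) ≡ r)
theorem3p27 n =
  (λ c κ → let ρ , code≡ , _ = decode-correct κ in ρ , code≡) ,
  (λ r → code-correct n)
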